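{- For $k\ge 2$, the number of minimal unavoidable subsets of $\overline{S_k}$ is at most $\binom{k!}{k!/2}$.
   Context: A totally vincular pattern of length $k$, written $\overline{\pi}$ for $\pi\in S_k$, is the pattern $\pi$ with all $k$ entries required to be consecutive; $\overline{S_k}$ is the set of all of them. A cyclic permutation $[\sigma]$ of length $n$ (the set of all rotations of $\sigma\in S_n$) contains $\overline{\pi}$ if some $k$ cyclically consecutive entries (indices mod $n$, $n\ge k$) are order-isomorphic to $\pi$; otherwise it avoids it. $\mathrm{Av}_n[\Pi]$ is the set of cyclic permutations of length $n$ avoiding every pattern in $\Pi$. A set $\Pi\subseteq\overline{S_k}$ is unavoidable if $|\mathrm{Av}_n[\Pi]|=0$ for all sufficiently large $n$, and avoidable otherwise; it is minimal unavoidable if it is unavoidable but every proper subset is avoidable. -}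

module Defs where

open import Data.Nat using (ℕ; zero; suc; _+_; _≤_)
open import Data.Nat.DivMod using (_mod_)
open import Data.Fin using (Fin; toℕ) renaming (_<_ to _<ᶠ_)
open import Data.Vec using (Vec; lookup)
open import Data.Bool using (Bool; true; false)
import Data.Product
open import Data.Product using (∃; ∃-syntax; _×_)
open import Relation.Binary.PropositionalEquality using (_≡_)
open import Relation.Nullary using (¬_)
open import Function.Bundles using (_⇔_)

IsPerm : ∀ {k} → Vec (Fin k) k → Set
IsPerm {k} v = ∀ (i j : Fin k) → lookup v i ≡ lookup v j → i ≡ j

-- A subset Π of S_k, given by its (decidable) indicator on one-line vectors;
-- only its values on permutations are relevant.
PatternSet : ℕ → Set
PatternSet k = Vec (Fin k) k → Bool

-- The cyclic permutation [σ] (σ ∈ S_{suc m}) contains the totally vincular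
-- pattern π̄ (π ∈ S_k): some k cyclically consecutive entries
-- σ(i), σ(i+1), …, σ(i+k-1) (indices mod n) are order-isomorphic to π.
-- Requires k ≤ n (imposed where used).
Contains : ∀ {k m} → Vec (Fin (suc m)) (suc m) → Vec (Fin k) k → Set
Contains {k} {m} σ π =
  Data.Product.∃ {A = Fin (suc m)} λ i → ∀ (a b : Fin k) →
    (lookup π a <ᶠ lookup π b) ⇔
    (lookup σ ((toℕ i + toℕ a) mod suc m) <ᶠ lookup σ ((toℕ i + toℕ b) mod suc m))

AvoidsAll : ∀ {k m} → PatternSet k → Vec (Fin (suc m)) (suc m) → Set
AvoidsAll {k} Π σ = ∀ (π : Vec (Fin k) k) → IsPerm π → Π π ≡ true → ¬ Contains σ π

-- Av_n[Π] is empty (n = suc m): no cyclic permutation of length n avoids Π.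
AvEmpty : ∀ {k} → PatternSet k → ℕ → Set
AvEmpty {k} Π m = ¬ (∃ {A = Vec (Fin (suc m)) (suc m)} λ σ → (IsPerm σ × AvoidsAll Π σ))

Unavoidable : (k : ℕ) → PatternSet k → Set
Unavoidable k Π = ∃[ N ] ∀ (m : ℕ) → N ≤ suc m → k ≤ suc m → AvEmpty Π m

Avoidable : (k : ℕ) → PatternSet k → Set
Avoidable k Π = ¬ Unavoidable k Π

_⊆ₚ_ : ∀ {k} → PatternSet k → PatternSet k → Set
_⊆ₚ_ {k} Π' Π = ∀ (v : Vec (Fin k) k) → IsPerm v → Π' v ≡ true → Π v ≡ true

ProperSubset : ∀ {k} → PatternSet k → PatternSet k → Set
ProperSubset {k} Π' Π =
  (Π' ⊆ₚ Π) × (∃[ v ] (IsPerm v × Π v ≡ true × Π' v ≡ false))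

MinimalUnavoidable : (k : ℕ) → PatternSet k → Set
MinimalUnavoidable k Π =
  Unavoidable k Π × (∀ (Π' : PatternSet k) → ProperSubset Π' Π → Avoidable k Π')

DifferentSets : ∀ {k} → PatternSet k → PatternSet k → Set
DifferentSets {k} Π Π' = ¬ (∀ (v : Vec (Fin k) k) → IsPerm v → Π v ≡ Π' v)

-- If Π ⊊ Π' were both minimal unavoidable, Π would be a proper unavoidable subset of Π',
-- contradicting the minimality of Π'. So distinct minimal unavoidable sets are
-- ⊆-incomparable, and after enumerating S_k by Fin (k !) they form an antichain of
-- subsets of a k!-element set; Sperner's theorem bounds its size by k! choose ⌊k!/2⌋.
-- Sperner's theorem follows from the LYM inequality Σ_{A ∈ F} |A|! (n − |A|)! ≤ n!,
-- proved by induction on n: for A ≠ [n+1], |A|! (n+1−|A|)! is the sum over x ∉ A of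
-- |A|! (n−|A|)!, and for each x the sets A ∖ {x} with x ∉ A ∈ F form an antichain in
-- [n+1] ∖ {x}.
module Submission where

open import Defs
open import Data.Nat using (ℕ; zero; suc; _+_; _*_; _∸_; _≤_; _<_; z≤n; _/_; _%_; _!)
open import Data.Nat.Properties
open import Data.Nat.Combinatorics using (_C_; k![n∸k]!∣n!; nCk≡n!/k![n-k]!)
open import Data.Nat.Divisibility using (∣⇒≤)
open import Data.Nat.DivMod using (m≡m%n+[m/n]*n; m%n<n; m/n*n≡m)
open import Data.Nat.ListAction using (sum)
open import Algebra.Properties.CommutativeMonoid.Sum +-0-commutativeMonoid
  using (sum-syntax; sum-cong-≗; ∑-distrib-+)
open import Data.Bool using (true; false)
import Data.Bool.Properties as Bool
open import Data.Fin using (Fin; zero; suc; punchIn; punchOut; remQuot; combine)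
import Data.Fin.Properties as Fin
open import Data.Fin.Subset using (Subset; inside; outside; _∈_; _∉_; _⊆_; _⊈_; ⊤; ∣_∣)
open import Data.Fin.Subset.Properties
  using (_∈?_; drop-there; ∣p∣≤n; ∣p∣≡n⇒p≡⊤; ⊆-refl; ⊆-reflexive; ⊆-trans; ⊆⊤)
open import Data.Vec using (Vec; []; _∷_; here; there; lookup; map; tabulate; removeAt)
open import Data.Vec.Properties
  using ([]=⇒lookup; lookup⇒[]=; removeAt-punchOut; lookup-map; lookup∘tabulate;
         tabulate∘lookup; tabulate-cong; tabulate-∘)
open import Data.List using (List; []; _∷_; [_]; length)
import Data.List as List
open import Data.List.Properties using (length-map)
open import Data.List.Relation.Unary.All using (All; []; _∷_)
import Data.List.Relation.Unary.All as All
open import Data.List.Relation.Unary.AllPairs using (AllPairs; []; _∷_)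
open import Data.List.Relation.Unary.AllPairs.Properties using (map⁺)
open import Data.Product using (_×_; _,_; proj₁; proj₂; ∃)
open import Data.Sum using (inj₁; inj₂)
open import Data.Empty using (⊥-elim)
open import Function using (_∘_)
open import Relation.Nullary using (¬_; yes; no; contradiction)
open import Relation.Unary using (Decidable)
open import Relation.Binary.PropositionalEquality hiding ([_])

private
  variable
    n m : ℕ

mapWithAll : ∀ {A : Set} {P : A → Set} {R S : A → A → Set} {xs : List A} →
  (∀ {x y} → P x → P y → R x y → S x y) → All P xs → AllPairs R xs → AllPairs S xs
mapWithAll f [] [] = []
mapWithAll f (px ∷ pxs) (rxs ∷ rs) =
  All.zipWith (λ (py , r) → f px py r) (pxs , rxs) ∷ mapWithAll f pxs rs

∑-const : ∀ n c → ∑[ i < n ] c ≡ n * c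
∑-const zero    c = refl
∑-const (suc n) c = cong (c +_) (∑-const n c)

∑-mono-≤ : ∀ {n} {f g : Fin n → ℕ} → (∀ i → f i ≤ g i) → ∑[ i < n ] f i ≤ ∑[ i < n ] g i
∑-mono-≤ {zero}  f≤g = z≤n
∑-mono-≤ {suc n} f≤g = +-mono-≤ (f≤g zero) (∑-mono-≤ (f≤g ∘ suc))

-- the number of maximal chains of subsets of an n-set passing through a given a-set
chains : ℕ → ℕ → ℕ
chains n a = a ! * (n ∸ a) !

chains≤! : ∀ {a} → a ≤ n → chains n a ≤ n !
chains≤! {n} a≤n = ∣⇒≤ {{n !≢0}} (k![n∸k]!∣n! a≤n)

C*chains≡! : ∀ {k} → k ≤ n → (n C k) * chains n k ≡ n !
C*chains≡! {n} {k} k≤n = begin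
  (n C k) * chains n k                 ≡⟨ cong (_* chains n k) (nCk≡n!/k![n-k]! k≤n) ⟩
  (n ! / chains n k) * chains n k      ≡⟨ m/n*n≡m (k![n∸k]!∣n! k≤n) ⟩
  n !                                  ∎
  where
  open ≡-Reasoning
  instance _ = k !* (n ∸ k) !≢0

chains-suc : ∀ {a} → a ≤ m → (suc m ∸ a) * chains m a ≡ chains (suc m) a
chains-suc {m} {a} a≤m = begin
  (suc m ∸ a) * (a ! * (m ∸ a) !)      ≡⟨ cong (_* chains m a) 1+m∸a≡1+[m∸a] ⟩
  suc (m ∸ a) * (a ! * (m ∸ a) !)      ≡⟨ x∙yz≈y∙xz (suc (m ∸ a)) (a !) ((m ∸ a) !) ⟩
  a ! * (suc (m ∸ a) * (m ∸ a) !)      ≡⟨ cong (λ b → a ! * b !) (sym 1+m∸a≡1+[m∸a]) ⟩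
  a ! * (suc m ∸ a) !                  ∎
  where
  open ≡-Reasoning
  open import Algebra.Properties.CommutativeSemigroup *-commutativeSemigroup using (x∙yz≈y∙xz)
  1+m∸a≡1+[m∸a] : suc m ∸ a ≡ suc (m ∸ a)
  1+m∸a≡1+[m∸a] = +-∸-assoc 1 a≤m

chains-sym : ∀ {a} → a ≤ n → chains n (n ∸ a) ≡ chains n a
chains-sym {n} {a} a≤n =
  trans (cong (λ b → (n ∸ a) ! * b !) (m∸[m∸n]≡n a≤n)) (*-comm ((n ∸ a) !) (a !))

chains-step : ∀ a → a + suc a ≤ n → chains n (suc a) ≤ chains n a
chains-step {n} a le = begin
  (suc a * a !) * (n ∸ suc a) !        ≡⟨ *-assoc (suc a) (a !) _ ⟩
  suc a * (a ! * (n ∸ suc a) !)        ≤⟨ *-monoˡ-≤ (a ! * (n ∸ suc a) !) 1+a≤n∸a ⟩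
  (n ∸ a) * (a ! * (n ∸ suc a) !)      ≡⟨ x∙yz≈y∙xz (n ∸ a) (a !) _ ⟩
  a ! * ((n ∸ a) * (n ∸ suc a) !)      ≡⟨ cong (λ b → a ! * (b * (n ∸ suc a) !)) n∸a≡1+[n∸1+a] ⟩
  a ! * (suc (n ∸ suc a)) !            ≡⟨ cong (λ b → a ! * b !) (sym n∸a≡1+[n∸1+a]) ⟩
  chains n a                           ∎
  where
  open ≤-Reasoning
  open import Algebra.Properties.CommutativeSemigroup *-commutativeSemigroup using (x∙yz≈y∙xz)
  1+a≤n∸a : suc a ≤ n ∸ a
  1+a≤n∸a = ≤-trans (≤-reflexive (sym (m+n∸m≡n a (suc a)))) (∸-monoˡ-≤ a le)
  n∸a≡1+[n∸1+a] : n ∸ a ≡ suc (n ∸ suc a)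
  n∸a≡1+[n∸1+a] = +-∸-assoc 1 (≤-trans (m≤n+m (suc a) a) le)

chains-antitone : ∀ {a} b → a ≤ b → b + b ≤ n → chains n b ≤ chains n a
chains-antitone zero    z≤n  _ = ≤-refl
chains-antitone (suc b) a≤1+b le with m≤n⇒m<n∨m≡n a≤1+b
... | inj₂ refl = ≤-refl
... | inj₁ a<1+b = ≤-trans (chains-step b (≤-trans (+-monoˡ-≤ (suc b) (n≤1+n b)) le))
                           (chains-antitone b (≤-pred a<1+b) (≤-trans (+-mono-≤ (n≤1+n b) (n≤1+n b)) le))

half+half≤n : ∀ n → n / 2 + n / 2 ≤ n
half+half≤n n = begin
  n / 2 + n / 2                        ≡⟨ cong (n / 2 +_) (sym (+-identityʳ (n / 2))) ⟩
  2 * (n / 2)                          ≡⟨ *-comm 2 (n / 2) ⟩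
  n / 2 * 2                            ≤⟨ m≤n+m _ (n % 2) ⟩
  n % 2 + n / 2 * 2                    ≡⟨ sym (m≡m%n+[m/n]*n n 2) ⟩
  n                                    ∎
  where open ≤-Reasoning

n≤1+half+half : ∀ n → n ≤ suc (n / 2 + n / 2)
n≤1+half+half n = begin
  n                                    ≡⟨ m≡m%n+[m/n]*n n 2 ⟩
  n % 2 + n / 2 * 2                    ≤⟨ +-monoˡ-≤ (n / 2 * 2) (≤-pred (m%n<n n 2)) ⟩
  suc (n / 2 * 2)                      ≡⟨ cong suc (*-comm (n / 2) 2) ⟩
  suc (2 * (n / 2))                    ≡⟨ cong (λ b → suc (n / 2 + b)) (+-identityʳ (n / 2)) ⟩
  suc (n / 2 + n / 2)                  ∎
  where open ≤-Reasoning

chains-minimal-at-half : ∀ {a} → a ≤ n → chains n (n / 2) ≤ chains n a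
chains-minimal-at-half {n} {a} a≤n with a ≤? n / 2
... | yes a≤h = chains-antitone (n / 2) a≤h (half+half≤n n)
... | no  a≰h = begin
  chains n (n / 2)                     ≤⟨ chains-antitone (n / 2) n∸a≤h (half+half≤n n) ⟩
  chains n (n ∸ a)                     ≡⟨ chains-sym a≤n ⟩
  chains n a                           ∎
  where
  open ≤-Reasoning
  n∸a≤h : n ∸ a ≤ n / 2
  n∸a≤h = begin
    n ∸ a                              ≤⟨ ∸-monoʳ-≤ n (≰⇒> a≰h) ⟩
    n ∸ suc (n / 2)                    ≤⟨ ∸-monoˡ-≤ (suc (n / 2)) (n≤1+half+half n) ⟩
    suc (n / 2 + n / 2) ∸ suc (n / 2)  ≡⟨ m+n∸m≡n (n / 2) (n / 2) ⟩
    n / 2                              ∎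

Incomparable : Subset n → Subset n → Set
Incomparable p q = p ⊈ q × q ⊈ p

∣p∣<n : (p : Subset n) → ¬ (⊤ ⊆ p) → ∣ p ∣ < n
∣p∣<n p ¬full = ≤∧≢⇒< (∣p∣≤n p) (λ ∣p∣≡n → ¬full (⊆-reflexive (sym (∣p∣≡n⇒p≡⊤ ∣p∣≡n))))

∣removeAt∣≡∣p∣ : ∀ (p : Subset (suc n)) {x} → x ∉ p → ∣ removeAt p x ∣ ≡ ∣ p ∣
∣removeAt∣≡∣p∣ (inside  ∷ p)         {zero}  x∉p = contradiction here x∉p
∣removeAt∣≡∣p∣ (outside ∷ p)         {zero}  x∉p = refl
∣removeAt∣≡∣p∣ (inside  ∷ p@(_ ∷ _)) {suc x} x∉p = cong suc (∣removeAt∣≡∣p∣ p (x∉p ∘ there))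
∣removeAt∣≡∣p∣ (outside ∷ p@(_ ∷ _)) {suc x} x∉p = ∣removeAt∣≡∣p∣ p (x∉p ∘ there)

∑-over-nonmembers : ∀ (p : Subset n) {c} {f : Fin n → ℕ} →
  (∀ {x} → x ∈ p → f x ≡ 0) → (∀ {x} → x ∉ p → f x ≡ c) → ∑[ x < n ] f x ≡ (n ∸ ∣ p ∣) * c
∑-over-nonmembers []            f∈ f∉ = refl
∑-over-nonmembers (inside  ∷ p) f∈ f∉ =
  cong₂ _+_ (f∈ here) (∑-over-nonmembers p (f∈ ∘ there) (λ x∉p → f∉ (x∉p ∘ drop-there)))
∑-over-nonmembers {suc n} (outside ∷ p) {c} {f} f∈ f∉ = begin
  f zero + ∑[ x < n ] f (suc x)        ≡⟨ cong₂ _+_ (f∉ (λ ()))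
                                            (∑-over-nonmembers p (f∈ ∘ there) (λ x∉p → f∉ (x∉p ∘ drop-there))) ⟩
  c + (n ∸ ∣ p ∣) * c                  ≡⟨ cong (_* c) (sym (+-∸-assoc 1 (∣p∣≤n p))) ⟩
  (suc n ∸ ∣ p ∣) * c                  ∎
  where open ≡-Reasoning

removeAt-⊆⁻ : ∀ {p q : Subset (suc n)} {x} → x ∉ p → removeAt p x ⊆ removeAt q x → p ⊆ q
removeAt-⊆⁻ {p = p} {q} {x} x∉p p-x⊆q-x {y} y∈p with x Fin.≟ y
... | yes refl = contradiction y∈p x∉p
... | no  x≢y  = lookup⇒[]= y q (begin
  lookup q y                           ≡⟨ removeAt-punchOut q x≢y ⟨
  lookup (removeAt q x) (punchOut x≢y) ≡⟨ []=⇒lookup (p-x⊆q-x (lookup⇒[]= _ _ p-x∋y)) ⟩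
  inside                               ∎)
  where
  open ≡-Reasoning
  p-x∋y : lookup (removeAt p x) (punchOut x≢y) ≡ inside
  p-x∋y = trans (removeAt-punchOut p x≢y) ([]=⇒lookup y∈p)

removeAt-incomparable : ∀ {p q : Subset (suc n)} {x} → x ∉ p → x ∉ q →
  Incomparable p q → Incomparable (removeAt p x) (removeAt q x)
removeAt-incomparable x∉p x∉q (p⊈q , q⊈p) = p⊈q ∘ removeAt-⊆⁻ x∉p , q⊈p ∘ removeAt-⊆⁻ x∉q

-- The LYM inequality and Sperner's theorem

totalChains : ∀ n → List (Subset n) → ℕ
totalChains n F = sum (List.map (λ p → chains n ∣ p ∣) F)

deletion : Fin (suc n) → List (Subset (suc n)) → List (Subset n)
deletion x []      = []
deletion x (p ∷ F) with x ∈? p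
... | yes _ = deletion x F
... | no  _ = removeAt p x ∷ deletion x F

deletion-all : ∀ x {p} (F : List (Subset (suc n))) → x ∉ p →
  All (Incomparable p) F → All (Incomparable (removeAt p x)) (deletion x F)
deletion-all x []      x∉p []           = []
deletion-all x (q ∷ F) x∉p (p∥q ∷ p∥F) with x ∈? q
... | yes _   = deletion-all x F x∉p p∥F
... | no  x∉q = removeAt-incomparable x∉p x∉q p∥q ∷ deletion-all x F x∉p p∥F

deletion-antichain : ∀ x (F : List (Subset (suc n))) →
  AllPairs Incomparable F → AllPairs Incomparable (deletion x F)
deletion-antichain x []      []            = []
deletion-antichain x (p ∷ F) (p∥F ∷ anti) with x ∈? p
... | yes _   = deletion-antichain x F anti
... | no  x∉p = deletion-all x F x∉p p∥F ∷ deletion-antichain x F anti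

totalChains-deletion-∷ : ∀ x (p : Subset (suc m)) F →
  totalChains m (deletion x (p ∷ F)) ≡ totalChains m (deletion x [ p ]) + totalChains m (deletion x F)
totalChains-deletion-∷ {m} x p F with x ∈? p
... | yes _ = refl
... | no  _ = cong (_+ totalChains m (deletion x F)) (sym (+-identityʳ _))

∑-totalChains-deletion-[] : (p : Subset (suc m)) → ¬ (⊤ ⊆ p) →
  ∑[ x < suc m ] totalChains m (deletion x [ p ]) ≡ chains (suc m) ∣ p ∣
∑-totalChains-deletion-[] {m} p ¬full =
  trans (∑-over-nonmembers p member nonmember) (chains-suc (≤-pred (∣p∣<n p ¬full)))
  where
  member : ∀ {x} → x ∈ p → totalChains m (deletion x [ p ]) ≡ 0
  member {x} x∈p with x ∈? p
  ... | yes _   = refl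
  ... | no  x∉p = contradiction x∈p x∉p
  nonmember : ∀ {x} → x ∉ p → totalChains m (deletion x [ p ]) ≡ chains m ∣ p ∣
  nonmember {x} x∉p with x ∈? p
  ... | yes x∈p = contradiction x∈p x∉p
  ... | no  _   = trans (+-identityʳ _) (cong (chains m) (∣removeAt∣≡∣p∣ p x∉p))

∑-totalChains-deletion : (F : List (Subset (suc m))) → All (λ p → ¬ (⊤ ⊆ p)) F →
  ∑[ x < suc m ] totalChains m (deletion x F) ≡ totalChains (suc m) F
∑-totalChains-deletion {m} []      []              = trans (∑-const m 0) (*-zeroʳ m)
∑-totalChains-deletion {m} (p ∷ F) (¬full ∷ ¬fulls) = begin
  ∑[ x < suc m ] totalChains m (deletion x (p ∷ F))
    ≡⟨ sum-cong-≗ (λ x → totalChains-deletion-∷ x p F) ⟩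
  ∑[ x < suc m ] (totalChains m (deletion x [ p ]) + totalChains m (deletion x F))
    ≡⟨ ∑-distrib-+ (λ x → totalChains m (deletion x [ p ])) (λ x → totalChains m (deletion x F)) ⟩
  ∑[ x < suc m ] totalChains m (deletion x [ p ]) + ∑[ x < suc m ] totalChains m (deletion x F)
    ≡⟨ cong₂ _+_ (∑-totalChains-deletion-[] p ¬full) (∑-totalChains-deletion F ¬fulls) ⟩
  totalChains (suc m) (p ∷ F) ∎
  where open ≡-Reasoning

antichain-nonfull : ∀ {p q : Subset n} {F} → AllPairs Incomparable (p ∷ q ∷ F) →
  All (λ r → ¬ (⊤ ⊆ r)) (p ∷ q ∷ F)
antichain-nonfull (((p⊈q , q⊈p) ∷ p∥F) ∷ _) =
  notFull q⊈p ∷ notFull p⊈q ∷ All.map (notFull ∘ proj₁) p∥F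
  where
  notFull : ∀ {r s : Subset _} → s ⊈ r → ¬ (⊤ ⊆ r)
  notFull s⊈r full = s⊈r (⊆-trans ⊆⊤ full)

lym : ∀ n (F : List (Subset n)) → AllPairs Incomparable F → totalChains n F ≤ n !
lym n       []                  _ = z≤n
lym n       (p ∷ [])            _ = ≤-trans (≤-reflexive (+-identityʳ _)) (chains≤! (∣p∣≤n p))
lym zero    ([] ∷ [] ∷ _)       (((p⊈q , _) ∷ _) ∷ _) = ⊥-elim (p⊈q ⊆-refl)
lym (suc m) F@(_ ∷ _ ∷ _)       anti = begin
  totalChains (suc m) F                ≡⟨ ∑-totalChains-deletion F (antichain-nonfull anti) ⟨
  ∑[ x < suc m ] totalChains m (deletion x F)
                                       ≤⟨ ∑-mono-≤ (λ x → lym m (deletion x F) (deletion-antichain x F anti)) ⟩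
  ∑[ x < suc m ] (m !)                 ≡⟨ ∑-const (suc m) (m !) ⟩
  suc m !                              ∎
  where open ≤-Reasoning

length*chains-half≤totalChains : ∀ (F : List (Subset n)) → length F * chains n (n / 2) ≤ totalChains n F
length*chains-half≤totalChains []      = z≤n
length*chains-half≤totalChains (p ∷ F) =
  +-mono-≤ (chains-minimal-at-half (∣p∣≤n p)) (length*chains-half≤totalChains F)

sperner : ∀ n (F : List (Subset n)) → AllPairs Incomparable F → length F ≤ n C (n / 2)
sperner n F anti = *-cancelʳ-≤ (length F) (n C (n / 2)) (chains n (n / 2)) (begin
  length F * chains n (n / 2)          ≤⟨ length*chains-half≤totalChains F ⟩
  totalChains n F                      ≤⟨ lym n F anti ⟩
  n !                                  ≡⟨ C*chains≡! (≤-trans (m≤m+n (n / 2) (n / 2)) (half+half≤n n)) ⟨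
  (n C (n / 2)) * chains n (n / 2)     ∎)
  where
  open ≤-Reasoning
  instance _ = (n / 2) !* (n ∸ n / 2) !≢0

-- Enumerating permutations

prepend : ∀ {k} → Fin (suc k) → Vec (Fin k) k → Vec (Fin (suc k)) (suc k)
prepend x σ = x ∷ map (punchIn x) σ

-- Lehmer code: remQuot (k !) splits Fin ((k + 1)!) as Fin (k + 1) × Fin (k !).
unrank : ∀ k → Fin (k !) → Vec (Fin k) k
unrank zero    _ = []
unrank (suc k) i = prepend (proj₁ xj) (unrank k (proj₂ xj))
  where xj = remQuot (k !) i

prepend-isPerm : ∀ {k} x {σ : Vec (Fin k) k} → IsPerm σ → IsPerm (prepend x σ)
prepend-isPerm x {σ} σ-perm zero    zero    _  = refl
prepend-isPerm x {σ} σ-perm zero    (suc j) eq =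
  contradiction (sym (trans eq (lookup-map j (punchIn x) σ))) (Fin.punchInᵢ≢i x (lookup σ j))
prepend-isPerm x {σ} σ-perm (suc i) zero    eq =
  contradiction (trans (sym (lookup-map i (punchIn x) σ)) eq) (Fin.punchInᵢ≢i x (lookup σ i))
prepend-isPerm x {σ} σ-perm (suc i) (suc j) eq = cong suc (σ-perm i j (Fin.punchIn-injective x _ _
  (trans (sym (lookup-map i (punchIn x) σ)) (trans eq (lookup-map j (punchIn x) σ)))))

prepend-onto : ∀ {k} x (τ : Vec (Fin (suc k)) k) → IsPerm (x ∷ τ) →
  ∃ λ σ → IsPerm σ × prepend x σ ≡ x ∷ τ
prepend-onto x τ x∷τ-perm = σ , σ-perm , cong (x ∷_) (begin
  map (punchIn x) σ                    ≡⟨ tabulate-∘ (punchIn x) (λ j → punchOut (x≢τ j)) ⟨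
  tabulate (λ j → punchIn x (punchOut (x≢τ j)))
                                       ≡⟨ tabulate-cong (λ j → Fin.punchIn-punchOut (x≢τ j)) ⟩
  tabulate (lookup τ)                  ≡⟨ tabulate∘lookup τ ⟩
  τ                                    ∎)
  where
  open ≡-Reasoning
  x≢τ : ∀ j → x ≢ lookup τ j
  x≢τ j eq with () ← x∷τ-perm zero (suc j) eq
  σ = tabulate (λ j → punchOut (x≢τ j))
  σ-perm : IsPerm σ
  σ-perm i j eq = Fin.suc-injective (x∷τ-perm (suc i) (suc j) (Fin.punchOut-injective (x≢τ i) (x≢τ j)
    (trans (sym (lookup∘tabulate _ i)) (trans eq (lookup∘tabulate _ j)))))

unrank-isPerm : ∀ k i → IsPerm (unrank k i)
unrank-isPerm zero    _ ()
unrank-isPerm (suc k) i = prepend-isPerm _ (unrank-isPerm k _)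

unrank-surjective : ∀ k (v : Vec (Fin k) k) → IsPerm v → ∃ λ i → unrank k i ≡ v
unrank-surjective zero    []      _      = zero , refl
unrank-surjective (suc k) (x ∷ τ) v-perm with prepend-onto x τ v-perm
... | σ , σ-perm , prepend-x-σ≡v with unrank-surjective k σ σ-perm
...   | j , unrank-j≡σ = combine x j , (begin
  unrank (suc k) (combine x j)         ≡⟨ cong (λ (y , i) → prepend y (unrank k i)) (Fin.remQuot-combine x j) ⟩
  prepend x (unrank k j)               ≡⟨ cong (prepend x) unrank-j≡σ ⟩
  prepend x σ                          ≡⟨ prepend-x-σ≡v ⟩
  x ∷ τ                                ∎)
  where open ≡-Reasoning

unrank-∀ : ∀ {k} {P : Vec (Fin k) k → Set} → (∀ i → P (unrank k i)) → ∀ v → IsPerm v → P v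
unrank-∀ {k} ∀P v v-perm with unrank-surjective k v v-perm
... | i , refl = ∀P i

perm-¬∀⟶∃¬ : ∀ {k} {P : Vec (Fin k) k → Set} → Decidable P →
  ¬ (∀ v → IsPerm v → P v) → ∃ λ v → IsPerm v × ¬ P v
perm-¬∀⟶∃¬ {k} {P} P? ¬∀P with Fin.¬∀⟶∃¬ (k !) (P ∘ unrank k) (P? ∘ unrank k) (¬∀P ∘ unrank-∀)
... | i , ¬P = unrank k i , unrank-isPerm k i , ¬P

-- Minimal unavoidable sets form an antichain

encode : ∀ {k} → PatternSet k → Subset (k !)
encode {k} Π = tabulate (Π ∘ unrank k)

encode-⊆ : ∀ {k} {Π Π' : PatternSet k} → encode Π ⊆ encode Π' → Π ⊆ₚ Π'
encode-⊆ {k} {Π} {Π'} ⊆ v v-perm Πv with unrank-surjective k v v-perm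
... | i , refl = trans (sym (lookup∘tabulate _ i))
  ([]=⇒lookup (⊆ (lookup⇒[]= i _ (trans (lookup∘tabulate _ i) Πv))))

⊆ₚ-different⇒proper : ∀ {k} {Π Π' : PatternSet k} → Π ⊆ₚ Π' → DifferentSets Π Π' → ProperSubset Π Π'
⊆ₚ-different⇒proper {Π = Π} {Π'} Π⊆Π' Π≠Π'
  with perm-¬∀⟶∃¬ (λ v → Π v Bool.≟ Π' v) Π≠Π'
... | v , v-perm , Πv≢Π'v with Π v in Πv | Π' v in Π'v
...   | false | true  = Π⊆Π' , v , v-perm , Π'v , Πv
...   | true  | _     = contradiction (trans (sym (Π⊆Π' v v-perm Πv)) Π'v) Πv≢Π'v
...   | false | false = contradiction refl Πv≢Π'v

DifferentSets-sym : ∀ {k} {Π Π' : PatternSet k} → DifferentSets Π Π' → DifferentSets Π' Π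
DifferentSets-sym Π≠Π' Π'≡Π = Π≠Π' (λ v v-perm → sym (Π'≡Π v v-perm))

minimalUnavoidable-incomparable : ∀ {k} {Π Π' : PatternSet k} →
  MinimalUnavoidable k Π → MinimalUnavoidable k Π' → DifferentSets Π Π' →
  Incomparable (encode Π) (encode Π')
minimalUnavoidable-incomparable (Π-unavoidable , Π-minimal) (Π'-unavoidable , Π'-minimal) Π≠Π' =
    (λ ⊆ → Π'-minimal _ (⊆ₚ-different⇒proper (encode-⊆ ⊆) Π≠Π') Π-unavoidable)
  , (λ ⊆ → Π-minimal _ (⊆ₚ-different⇒proper (encode-⊆ ⊆) (DifferentSets-sym Π≠Π')) Π'-unavoidable)

-- The bound holds for every k.
proposition6p2 : (k : ℕ) → 2 ≤ k →
    (L : List (PatternSet k)) →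
    All (MinimalUnavoidable k) L →
    AllPairs DifferentSets L →
    length L ≤ (k !) C ((k !) / 2)
proposition6p2 k _ L minimal distinct = begin
  length L                             ≡⟨ length-map encode L ⟨
  length (List.map encode L)           ≤⟨ sperner (k !) (List.map encode L) encodings-antichain ⟩
  (k !) C ((k !) / 2)                  ∎
  where
  open ≤-Reasoning
  encodings-antichain : AllPairs Incomparable (List.map encode L)
  encodings-antichain = map⁺ (mapWithAll minimalUnavoidable-incomparable minimal distinct)
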